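{- Let $\Phi=(\{1\},C,X,Y_0,Y_1,A_1,\Delta,\Lambda)$ be a binary frame template in standard form, with witnessing sets $C_0,C_1,X_0,X_1$, such that $\Lambda|X_1$ is nontrivial. Then $\Phi_X\preceq\Phi$.
   Context: All matrices are over $\mathrm{GF}(2)$. For finite sets $R,S$, a matrix in $\mathrm{GF}(2)^{R\times S}$ has rows indexed by $R$ and columns indexed by $S$, and $A[R',S']$ is the submatrix on rows $R'$ and columns $S'$. A frame matrix is a matrix each of whose columns has at most two nonzero entries. For a subgroup $G$ of $\mathrm{GF}(2)^S$ and $S'\subseteq S$, $G|S'$ is the projection of $G$ to $\mathrm{GF}(2)^{S'}$; $M(A)$ is the column matroid of $A$. A binary frame template is a tuple $\Phi=(\Gamma,C,X,Y_0,Y_1,A_1,\Delta,\Lambda)$ where $\Gamma=\{1\}$ is the trivial group, $C,X,Y_0,Y_1$ are pairwise disjoint finite sets, $A_1\in\mathrm{GF}(2)^{X\times(C\cup Y_0\cup Y_1)}$, $\Lambda$ is a subgroup of $\mathrm{GF}(2)^X$ and $\Delta$ is a subgroup of $\mathrm{GF}(2)^{C\cup Y_0\cup Y_1}$. $\Phi$ is in standard form if there are pairwise disjoint sets $C_0,C_1,X_0,X_1$ with $C=C_0\cup C_1$, $X=X_0\cup X_1$, $A_1[X_0,C_0]$ an identity matrix (up to a bijection $X_0\to C_0$), and $A_1[X_1,C]$ a zero matrix. A matrix $A'\in\mathrm{GF}(2)^{B\times E}$ virtually respects $\Phi$ if: (i) $X\subseteq B$ and $C\cup Y_0\cup Y_1\subseteq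 E$; (ii) $A'[X,C\cup Y_0\cup Y_1]=A_1$; (iii) there is $Z\subseteq E-(C\cup Y_0\cup Y_1)$ with $A'[X,Z]=0$, each column of $A'[B-X,Z]$ a unit vector or a zero vector, and $A'[B-X,E-(C\cup Y_0\cup Y_1\cup Z)]$ a frame matrix; (iv) each column of $A'[X,E-(C\cup Y_0\cup Y_1\cup Z)]$ lies in $\Lambda$; (v) each row of $A'[B-X,C\cup Y_0\cup Y_1]$ lies in $\Delta$. A matrix $A\in\mathrm{GF}(2)^{B\times E}$ virtually conforms to $\Phi$ if there is such an $A'$ (with $Z$ as in (iii)) with $A[B,E-Z]=A'[B,E-Z]$ and, for each $i\in Z$, some $j\in Y_1$ such that column $i$ of $A$ is the sum of columns $i$ and $j$ of $A'$. A matroid $M$ virtually conforms to $\Phi$ if $M\cong M(A)/C\backslash Y_1$ for some $A$ virtually conforming to $\Phi$. Template minors: the following operations produce a new binary frame template from $\Phi$. (2) Replace $\Lambda$ by a subgroup. (3) Replace $\Delta$ by a subgroup. (4) Remove some $y\in Y_1$ from $Y_1$, deleting column $y$ of $A_1$ and projecting $\Delta$ to the remaining coordinates. (5) Apply an elementary row operation (swap two rows, or add one row to another) to the rows of $A_1$ and simultaneously the same operation to the coordinates of every element of $\Lambda$. (6) If $x\in X$ is such that row $x$ of $A_1$ is zero and $\lambda_x=0$ for all $\lambda\in\Lambda$, remove $x$ from $X$ (delete row $x$, project $\Lambda$ to $X-x$). (7) If $c\in C$ is such that column $c$ of $A_1$ is the unit vector with its $1$ in row $x$, and either $\lambda_x=0$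 for all $\lambda\in\Lambda$ or $\delta_c=0$ for all $\delta\in\Delta$, replace each $\delta\in\Delta$ by $\delta+\delta_cA_1[\{x\},C\cup Y_0\cup Y_1]$, then remove $c$ from $C$ and $x$ from $X$ (replace $A_1$ by $A_1[X-x,(C-c)\cup Y_0\cup Y_1]$, $\Lambda$ by $\Lambda|(X-x)$, and the new $\Delta$ by its projection to $(C-c)\cup Y_0\cup Y_1$). (8) If $c\in C$ has column $c$ of $A_1$ zero and $\delta_c=0$ for all $\delta\in\Delta$, remove $c$ from $C$ (delete the column, project $\Delta$). (10) Remove some $y\in Y_0$ from $Y_0$ (delete column $y$ of $A_1$, project $\Delta$). (11) If $x\in X$ has $\lambda_x=0$ for all $\lambda\in\Lambda$ and $y\in Y_0$ has $(A_1)_{x,y}=1$: add row $x$ of $A_1$ to every other row $r$ with $(A_1)_{r,y}=1$; replace each $\delta\in\Delta$ by $\delta+\delta_yA_1[\{x\},C\cup Y_0\cup Y_1]$ (using the new $A_1$); then delete row $x$ and column $y$ of $A_1$, project $\Lambda$ to $X-x$ and $\Delta$ to $C\cup(Y_0-y)\cup Y_1$. (12) If $y\in Y_0$ has $\delta_y=0$ for all $\delta\in\Delta$: if column $y$ of $A_1$ is zero, remove $y$ as in (10); otherwise choose $x$ with $(A_1)_{x,y}=1$, add row $x$ to every other row $r$ with $(A_1)_{r,y}=1$ while applying the same row operations to the coordinates of every element of $\Lambda$, then delete row $x$ and column $y$ of $A_1$, project $\Lambda$ to $X-x$ and $\Delta$ to $C\cup(Y_0-y)\cup Y_1$. A template minor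 of $\Phi$ is a template obtained from $\Phi$ by a finite sequence of these operations. A matroid weakly conforms to $\Phi$ if it virtually conforms to some template minor of $\Phi$; $\mathcal{M}_w(\Phi)$ denotes the class of such matroids. Write $\Phi\preceq\Psi$ if $\mathcal{M}_w(\Phi)\subseteq\mathcal{M}_w(\Psi)$. $\Phi_X$ is the template with $|X|=1$, $C=Y_0=Y_1=\emptyset$, $\Lambda=\mathrm{GF}(2)^X$, $\Delta$ trivial. -}

module Defs where

open import Data.Bool using (Bool; true; false; not; _∧_; _∨_; _xor_)
open import Data.Nat using (ℕ; zero; suc; _+_; _≤_)
open import Data.Fin using (Fin; punchIn; _≟_)
import Data.Fin as F
open import Data.Sum using (_⊎_; inj₁; inj₂)
open import Data.Product using (Σ; Σ-syntax; _×_; _,_; proj₁; proj₂)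
open import Data.Unit using (⊤; tt)
open import Data.List using (List; []; _∷_; foldr)
open import Data.List.Relation.Unary.All using (All)
open import Data.List.Relation.Unary.Unique.Propositional using (Unique)
open import Relation.Nullary using (¬_; does)
open import Relation.Binary.PropositionalEquality using (_≡_; _≢_; refl; sym; trans; cong)
open import Function.Bundles using (_↔_; _⇔_; Inverse)

-- GF(2) = Bool, addition = xor.  Vectors in GF(2)^S are functions S → Bool.

Vect : Set → Set
Vect S = S → Bool

_⊕_ : ∀ {S : Set} → Vect S → Vect S → Vect S
(u ⊕ v) i = u i xor v i

0v : ∀ {S : Set} → Vect S
0v _ = false

bit : Bool → ℕ
bit true  = 1
bit false = 0

count : ∀ {n} → Vect (Fin n) → ℕ
count {zero}  f = 0
count {suc n} f = bit (f F.zero) + count (λ i → f (F.suc i))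

record Subgroup (S : Set) : Set₁ where
  field
    mem   : Vect S → Set
    ext   : ∀ {u v} → (∀ i → u i ≡ v i) → mem u → mem v
    has0  : mem 0v
    close : ∀ {u v} → mem u → mem v → mem (u ⊕ v)
open Subgroup public

record LinMap (S S' : Set) : Set where
  field
    fun   : Vect S → Vect S'
    pres0 : ∀ i → fun 0v i ≡ false
    pres⊕ : ∀ u v i → fun (u ⊕ v) i ≡ (fun u ⊕ fun v) i
open LinMap public

image : ∀ {S S'} → LinMap S S' → Subgroup S → Subgroup S'
image {S} {S'} f G = record
  { mem   = λ v → Σ[ u ∈ Vect S ] (mem G u × (∀ i → fun f u i ≡ v i))
  ; ext   = λ e (u , m , p) → u , m , (λ i → trans (p i) (e i))
  ; has0  = 0v , has0 G , pres0 f
  ; close = λ { (u , mu , pu) (w , mw , pw) →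
               (u ⊕ w) , close G mu mw ,
               (λ i → trans (pres⊕ f u w i) (cong₂' (pu i) (pw i))) } }
  where
  cong₂' : ∀ {a b c d} → a ≡ b → c ≡ d → (a xor c) ≡ (b xor d)
  cong₂' refl refl = refl

-- precomposition v ↦ v ∘ g (for g an embedding this is projection G|S')
precomp : ∀ {S S'} → (S' → S) → LinMap S S'
precomp g = record { fun = λ u i → u (g i) ; pres0 = λ _ → refl ; pres⊕ = λ _ _ _ → refl }

proj : ∀ {S S'} → (S' → S) → Subgroup S → Subgroup S'
proj g G = image (precomp g) G

shear : ∀ {S} → S → Vect S → LinMap S S
shear {S} p a = record
  { fun = λ u k → u k xor (a k ∧ u p)
  ; pres0 = λ k → z (a k)
  ; pres⊕ = λ u v k → lem (u k) (v k) (u p) (v p) (a k) }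
  where
  z : ∀ b → (false xor (b ∧ false)) ≡ false
  z true = refl
  z false = refl
  lem : ∀ uk vk up vp ak →
        ((uk xor vk) xor (ak ∧ (up xor vp))) ≡ ((uk xor (ak ∧ up)) xor (vk xor (ak ∧ vp)))
  lem true true true true true = refl
  lem true true true true false = refl
  lem true true true false true = refl
  lem true true true false false = refl
  lem true true false true true = refl
  lem true true false true false = refl
  lem true true false false true = refl
  lem true true false false false = refl
  lem true false true true true = refl
  lem true false true true false = refl
  lem true false true false true = refl
  lem true false true false false = refl
  lem true false false true true = refl
  lem true false false true false = refl
  lem true false false false true = refl
  lem true false false false false = refl
  lem false true true true true = refl
  lem false true true true false = refl
  lem false true true false true = refl
  lem false true true false false = refl
  lem false true false true true = refl
  lem false true false true false = refl
  lem false true false false true = refl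
  lem false true false false false = refl
  lem false false true true true = refl
  lem false false true true false = refl
  lem false false true false true = refl
  lem false false true false false = refl
  lem false false false true true = refl
  lem false false false true false = refl
  lem false false false false true = refl
  lem false false false false false = refl

fullSG : ∀ {S} → Subgroup S
fullSG = record { mem = λ _ → ⊤ ; ext = λ _ _ → tt ; has0 = tt ; close = λ _ _ → tt }

trivSG : ∀ {S} → Subgroup S
trivSG = record
  { mem = λ v → ∀ i → v i ≡ false
  ; ext = λ e m i → trans (sym (e i)) (m i)
  ; has0 = λ _ → refl
  ; close = λ {u} {v} mu mv i → lem (mu i) (mv i) }
  where
  lem : ∀ {a b} → a ≡ false → b ≡ false → (a xor b) ≡ false
  lem refl refl = refl

_==_ : ∀ {n} → Fin n → Fin n → Bool
i == j = does (i ≟ j)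

-- Binary frame templates (Γ = {1} is trivial and is omitted).
-- C = Fin c, X = Fin x, Y₀ = Fin y0, Y₁ = Fin y1;
-- the column set C ∪ Y₀ ∪ Y₁ is the disjoint union TCols c y0 y1.

TCols : ℕ → ℕ → ℕ → Set
TCols c y0 y1 = Fin c ⊎ (Fin y0 ⊎ Fin y1)

colC : ∀ {c y0 y1} → Fin c → TCols c y0 y1
colC k = inj₁ k

colY0 : ∀ {c y0 y1} → Fin y0 → TCols c y0 y1
colY0 k = inj₂ (inj₁ k)

colY1 : ∀ {c y0 y1} → Fin y1 → TCols c y0 y1
colY1 k = inj₂ (inj₂ k)

record Template (c x y0 y1 : ℕ) : Set₁ where
  field
    A1 : Fin x → TCols c y0 y1 → Bool
    Δ  : Subgroup (TCols c y0 y1)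
    Λ  : Subgroup (Fin x)
open Template public

-- standard form, with witnessing sets X₀ (X₁ = complement) and C₀ (C₁ = complement),
-- and a bijection σ : X₀ → C₀ such that A1[X₀,C₀] is the identity w.r.t. σ
-- and A1[X₁,C] = 0.
record StandardForm {c x y0 y1} (Φ : Template c x y0 y1) : Set where
  field
    X0    : Fin x → Bool
    C0    : Fin c → Bool
    σ     : (i : Fin x) → X0 i ≡ true → Fin c
    σ-in  : ∀ i p → C0 (σ i p) ≡ true
    σ-inj : ∀ i j p q → σ i p ≡ σ j q → i ≡ j
    σ-sur : ∀ k → C0 k ≡ true → Σ[ i ∈ Fin x ] Σ[ p ∈ X0 i ≡ true ] σ i p ≡ k
    ident : ∀ i p k → C0 k ≡ true → A1 Φ i (colC k) ≡ (σ i p == k)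
    zeroX1 : ∀ i → X0 i ≡ false → ∀ k → A1 Φ i (colC k) ≡ false
open StandardForm public

X1 : ∀ {c x y0 y1} {Φ : Template c x y0 y1} → StandardForm Φ → Set
X1 {x = x} sf = Σ[ i ∈ Fin x ] X0 sf i ≡ false

Nontrivial : ∀ {S} → Subgroup S → Set
Nontrivial {S} G = Σ[ v ∈ Vect S ] (mem G v × Σ[ i ∈ S ] v i ≡ true)

embC : ∀ {c y0 y1} → Fin (suc c) → TCols c y0 y1 → TCols (suc c) y0 y1
embC p (inj₁ k) = inj₁ (punchIn p k)
embC p (inj₂ t) = inj₂ t

embY0 : ∀ {c y0 y1} → Fin (suc y0) → TCols c y0 y1 → TCols c (suc y0) y1
embY0 p (inj₁ k) = inj₁ k
embY0 p (inj₂ (inj₁ k)) = inj₂ (inj₁ (punchIn p k))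
embY0 p (inj₂ (inj₂ k)) = inj₂ (inj₂ k)

embY1 : ∀ {c y0 y1} → Fin (suc y1) → TCols c y0 y1 → TCols c y0 (suc y1)
embY1 p (inj₁ k) = inj₁ k
embY1 p (inj₂ (inj₁ k)) = inj₂ (inj₁ k)
embY1 p (inj₂ (inj₂ k)) = inj₂ (inj₂ (punchIn p k))

swapF : ∀ {n} → Fin n → Fin n → Fin n → Fin n
swapF i j r with r == i | r == j
... | true  | _     = j
... | false | true  = i
... | false | false = r

rowShear : ∀ {x c y0 y1} → Fin x → Vect (Fin x) →
           (Fin x → TCols c y0 y1 → Bool) → (Fin x → TCols c y0 y1 → Bool)
rowShear p coef A r t = A r t xor (coef r ∧ A p t)

-- The template-minor operations (numbered as in the paper)

data Step : ∀ {c x y0 y1 c' x' y0' y1'} →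
            Template c x y0 y1 → Template c' x' y0' y1' → Set₁ where
  op2 : ∀ {c x y0 y1} (Φ : Template c x y0 y1) (Λ' : Subgroup (Fin x)) →
        (∀ v → mem Λ' v → mem (Λ Φ) v) →
        Step Φ (record { A1 = A1 Φ ; Δ = Δ Φ ; Λ = Λ' })
  op3 : ∀ {c x y0 y1} (Φ : Template c x y0 y1) (Δ' : Subgroup (TCols c y0 y1)) →
        (∀ v → mem Δ' v → mem (Δ Φ) v) →
        Step Φ (record { A1 = A1 Φ ; Δ = Δ' ; Λ = Λ Φ })
  op4 : ∀ {c x y0 y1} (Φ : Template c x y0 (suc y1)) (y : Fin (suc y1)) →
        Step Φ (record { A1 = λ r t → A1 Φ r (embY1 y t)
                       ; Δ = proj (embY1 y) (Δ Φ) ; Λ = Λ Φ })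
  op5swap : ∀ {c x y0 y1} (Φ : Template c x y0 y1) (i j : Fin x) →
        Step Φ (record { A1 = λ r t → A1 Φ (swapF i j r) t
                       ; Δ = Δ Φ ; Λ = image (precomp (swapF i j)) (Λ Φ) })
  op5add : ∀ {c x y0 y1} (Φ : Template c x y0 y1) (i j : Fin x) → i ≢ j →
        Step Φ (record { A1 = rowShear i (λ r → r == j) (A1 Φ)
                       ; Δ = Δ Φ ; Λ = image (shear i (λ r → r == j)) (Λ Φ) })
  op6 : ∀ {c x y0 y1} (Φ : Template c (suc x) y0 y1) (p : Fin (suc x)) →
        (∀ t → A1 Φ p t ≡ false) → (∀ v → mem (Λ Φ) v → v p ≡ false) →
        Step Φ (record { A1 = λ r t → A1 Φ (punchIn p r) t
                       ; Δ = Δ Φ ; Λ = proj (punchIn p) (Λ Φ) })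
  op7 : ∀ {c x y0 y1} (Φ : Template (suc c) (suc x) y0 y1)
          (k : Fin (suc c)) (p : Fin (suc x)) →
        (∀ r → A1 Φ r (colC k) ≡ (r == p)) →
        ((∀ v → mem (Λ Φ) v → v p ≡ false) ⊎ (∀ v → mem (Δ Φ) v → v (colC k) ≡ false)) →
        Step Φ (record { A1 = λ r t → A1 Φ (punchIn p r) (embC k t)
                       ; Δ = proj (embC k) (image (shear (colC k) (A1 Φ p)) (Δ Φ))
                       ; Λ = proj (punchIn p) (Λ Φ) })
  op8 : ∀ {c x y0 y1} (Φ : Template (suc c) x y0 y1) (k : Fin (suc c)) →
        (∀ r → A1 Φ r (colC k) ≡ false) → (∀ v → mem (Δ Φ) v → v (colC k) ≡ false) →
        Step Φ (record { A1 = λ r t → A1 Φ r (embC k t)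
                       ; Δ = proj (embC k) (Δ Φ) ; Λ = Λ Φ })
  op10 : ∀ {c x y0 y1} (Φ : Template c x (suc y0) y1) (y : Fin (suc y0)) →
        Step Φ (record { A1 = λ r t → A1 Φ r (embY0 y t)
                       ; Δ = proj (embY0 y) (Δ Φ) ; Λ = Λ Φ })
  op11 : ∀ {c x y0 y1} (Φ : Template c (suc x) (suc y0) y1)
           (p : Fin (suc x)) (y : Fin (suc y0)) →
         (∀ v → mem (Λ Φ) v → v p ≡ false) → A1 Φ p (colY0 y) ≡ true →
         let coef = λ r → A1 Φ r (colY0 y) ∧ not (r == p)
             A1n  = rowShear p coef (A1 Φ)
         in Step Φ (record { A1 = λ r t → A1n (punchIn p r) (embY0 y t)
                           ; Δ = proj (embY0 y) (image (shear (colY0 y) (A1n p)) (Δ Φ))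
                           ; Λ = proj (punchIn p) (Λ Φ) })
  -- (12) y ∈ Y₀ with δ_y = 0 for all δ ∈ Δ and nonzero column (pivot row p);
  --      the zero-column case of (12) is exactly operation (10).
  op12 : ∀ {c x y0 y1} (Φ : Template c (suc x) (suc y0) y1)
           (p : Fin (suc x)) (y : Fin (suc y0)) →
         (∀ v → mem (Δ Φ) v → v (colY0 y) ≡ false) → A1 Φ p (colY0 y) ≡ true →
         let coef = λ r → A1 Φ r (colY0 y) ∧ not (r == p)
             A1n  = rowShear p coef (A1 Φ)
         in Step Φ (record { A1 = λ r t → A1n (punchIn p r) (embY0 y t)
                           ; Δ = proj (embY0 y) (Δ Φ)
                           ; Λ = proj (punchIn p) (image (shear p coef) (Λ Φ)) })

data TMinor {c x y0 y1} (Φ : Template c x y0 y1) :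
            ∀ {c' x' y0' y1'} → Template c' x' y0' y1' → Set₁ where
  done : TMinor Φ Φ
  step : ∀ {c' x' y0' y1' c'' x'' y0'' y1''}
           {Ψ : Template c' x' y0' y1'} {Θ : Template c'' x'' y0'' y1''} →
         TMinor Φ Ψ → Step Ψ Θ → TMinor Φ Θ

-- Rows B = X ⊎ Fin b (so B − X = Fin b);
-- columns E = (C ∪ Y₀ ∪ Y₁) ⊎ (Z ⊎ W) with Z = Fin z, W = Fin w
-- (W = E − (C ∪ Y₀ ∪ Y₁ ∪ Z)).  Only matroids up to isomorphism matter,
-- so fixing this ordering of rows and columns loses no generality.

Rows : ℕ → ℕ → Set
Rows x b = Fin x ⊎ Fin b

Cols : ℕ → ℕ → ℕ → ℕ → ℕ → Set
Cols c y0 y1 z w = TCols c y0 y1 ⊎ (Fin z ⊎ Fin w)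

Mat : ∀ (c x y0 y1 b z w : ℕ) → Set
Mat c x y0 y1 b z w = Rows x b → Cols c y0 y1 z w → Bool

colZ : ∀ {c y0 y1 z w} → Fin z → Cols c y0 y1 z w
colZ k = inj₂ (inj₁ k)

colW : ∀ {c y0 y1 z w} → Fin w → Cols c y0 y1 z w
colW k = inj₂ (inj₂ k)

VirtuallyRespects : ∀ {c x y0 y1} (Φ : Template c x y0 y1) {b z w} →
                    Mat c x y0 y1 b z w → Set
VirtuallyRespects {c} {x} {y0} {y1} Φ {b} {z} {w} A' =
    (∀ r t → A' (inj₁ r) (inj₁ t) ≡ A1 Φ r t)
  × (∀ r k → A' (inj₁ r) (colZ k) ≡ false)
  × (∀ k → count (λ r → A' (inj₂ r) (colZ k)) ≤ 1)
  × (∀ k → count (λ r → A' (inj₂ r) (colW k)) ≤ 2)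
  × (∀ k → mem (Λ Φ) (λ r → A' (inj₁ r) (colW k)))
  × (∀ r → mem (Δ Φ) (λ t → A' (inj₂ r) (inj₁ t)))

VirtuallyConforms : ∀ {c x y0 y1} (Φ : Template c x y0 y1) {b z w} →
                    Mat c x y0 y1 b z w → Set
VirtuallyConforms {c} {x} {y0} {y1} Φ {b} {z} {w} A =
  Σ[ A' ∈ Mat c x y0 y1 b z w ]
    ( VirtuallyRespects Φ A'
    × (∀ r t → A r (inj₁ t) ≡ A' r (inj₁ t))
    × (∀ r k → A r (colW k) ≡ A' r (colW k))
    × (∀ k → Σ[ j ∈ Fin y1 ] (∀ r → A r (colZ k) ≡ (A' r (colZ k) xor A' r (inj₁ (colY1 j))))))

-- Matroids, given by their independent sets; subsets are Bool-valued.

SetSys : Set → Set₁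
SetSys E = Vect E → Set

_⊆_ : ∀ {E} → Vect E → Vect E → Set
I ⊆ J = ∀ e → I e ≡ true → J e ≡ true

colSum : ∀ {R E : Set} → (R → E → Bool) → List E → Vect R
colSum A l r = foldr (λ e acc → A r e xor acc) false l

ColumnMatroid : ∀ {R E : Set} → (R → E → Bool) → SetSys E
ColumnMatroid {R} {E} A I =
  ∀ (l : List E) → Unique l → l ≢ [] → All (λ e → I e ≡ true) l →
  ¬ (∀ r → colSum A l r ≡ false)

IsBasisOf : ∀ {E} → SetSys E → Vect E → Vect E → Set
IsBasisOf {E} M S B =
  B ⊆ S × M B × (∀ (J : Vect E) → B ⊆ J → J ⊆ S → M J → J ⊆ B)

Contract : ∀ {E} → SetSys E → Vect E → SetSys E
Contract {E} M S I = Σ[ B ∈ Vect E ] (IsBasisOf M S B × M (λ e → I e ∨ B e))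

_≅_ : ∀ {E F : Set} → SetSys E → SetSys F → Set
_≅_ {E} {F} M N = Σ[ f ∈ E ↔ F ] (∀ (I : Vect F) → M (λ e → I (Inverse.to f e)) ⇔ N I)

-- M(A)/C\Y₁ : ground set Y₀ ∪ Z ∪ W = Fin y0 ⊎ (Fin z ⊎ Fin w)

Ground : ℕ → ℕ → ℕ → Set
Ground y0 z w = Fin y0 ⊎ (Fin z ⊎ Fin w)

inCset : ∀ {c y0 y1 z w} → Vect (Cols c y0 y1 z w)
inCset (inj₁ (inj₁ _)) = true
inCset _ = false

liftSet : ∀ {c y0 y1 z w} → Vect (Ground y0 z w) → Vect (Cols c y0 y1 z w)
liftSet J (inj₁ (inj₁ _)) = false
liftSet J (inj₁ (inj₂ (inj₁ k))) = J (inj₁ k)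
liftSet J (inj₁ (inj₂ (inj₂ _))) = false
liftSet J (inj₂ e) = J (inj₂ e)

MinorMatroid : ∀ {c x y0 y1 b z w} → Mat c x y0 y1 b z w → SetSys (Ground y0 z w)
MinorMatroid A J = Contract (ColumnMatroid A) inCset (liftSet J)

VConformsM : ∀ {c x y0 y1} → Template c x y0 y1 → ∀ {n} → SetSys (Fin n) → Set
VConformsM {c} {x} {y0} {y1} Ψ M =
  Σ[ b ∈ ℕ ] Σ[ z ∈ ℕ ] Σ[ w ∈ ℕ ] Σ[ A ∈ Mat c x y0 y1 b z w ]
    (VirtuallyConforms Ψ A × (M ≅ MinorMatroid A))

WeaklyConforms : ∀ {c x y0 y1} → Template c x y0 y1 → ∀ {n} → SetSys (Fin n) → Set₁
WeaklyConforms Φ M =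
  Σ[ c' ∈ ℕ ] Σ[ x' ∈ ℕ ] Σ[ y0' ∈ ℕ ] Σ[ y1' ∈ ℕ ] Σ[ Ψ ∈ Template c' x' y0' y1' ]
    (TMinor Φ Ψ × VConformsM Ψ M)

_⪯_ : ∀ {c x y0 y1 c' x' y0' y1'} → Template c x y0 y1 → Template c' x' y0' y1' → Set₁
Φ ⪯ Ψ = ∀ (n : ℕ) (M : SetSys (Fin n)) → WeaklyConforms Φ M → WeaklyConforms Ψ M

ΦX : Template 0 1 0 0
ΦX = record { A1 = λ _ _ → false ; Δ = trivSG ; Λ = fullSG }

-- Fix λ ∈ Λ with λ_x = 1 for some x ∈ X₁.  With Δ replaced by the zero group, each column
-- of the identity block A1[X₀,C₀] can be contracted (7) together with its row; as A1[X₁,C] = 0,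
-- once the rows X₀ are gone the columns of C₁ are zero and are deleted (8).  Then Y₁ and Y₀
-- are deleted.  Among the remaining rows, every row r ≠ x is cleared from λ by adding row x
-- to it (5), and removed (6) after shrinking Λ to {0, λ} (2).  The single row x that is left
-- has Λ = GF(2), which is Φ_X: a template without columns is determined by Δ and Λ.
module Submission where

open import Defs
open import Data.Bool using (Bool; true; false; _xor_; _∧_)
open import Data.Bool.Properties using (xor-identityʳ; xor-same)
import Data.Bool.Properties as Bool
open import Data.Nat using (ℕ; zero; suc)
open import Data.Fin using (Fin; punchIn; punchOut; _≟_)
import Data.Fin as Fin
open import Data.Fin.Properties using (punchIn-injective; punchInᵢ≢i; punchIn-punchOut; any?)
open import Data.Sum using (_⊎_; inj₁; inj₂)
open import Data.Product using (proj₁; Σ-syntax; _×_; _,_)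
open import Data.Unit using (⊤)
open import Data.Empty using (⊥; ⊥-elim)
open import Function using (_∘_)
open import Relation.Nullary using (yes; no)
open import Relation.Nullary.Decidable using (dec-true; dec-false)
open import Relation.Binary.PropositionalEquality
  using (_≡_; _≢_; refl; sym; trans; cong; cong₂; subst)

==-refl : ∀ {n} (i : Fin n) → (i == i) ≡ true
==-refl i = dec-true (i ≟ i) refl

==-≢ : ∀ {n} {i j : Fin n} → i ≢ j → (i == j) ≡ false
==-≢ {i = i} {j} = dec-false (i ≟ j)

==-punchIn : ∀ {n} (p : Fin (suc n)) (r q : Fin n) → (punchIn p r == punchIn p q) ≡ (r == q)
==-punchIn p r q with r ≟ q
... | yes refl = ==-refl (punchIn p r)
... | no r≢q = ==-≢ (r≢q ∘ punchIn-injective p r q)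

punchIn-surjective : ∀ {n} {P : Fin (suc n) → Set} (p : Fin (suc n)) {i} → p ≢ i → P i →
                     Σ[ j ∈ Fin n ] P (punchIn p j)
punchIn-surjective {P = P} p p≢i Pi = punchOut p≢i , subst P (sym (punchIn-punchOut p≢i)) Pi

true≢false : true ≢ false
true≢false ()

noColumns : TCols 0 0 0 → ⊥
noColumns (inj₁ ())
noColumns (inj₂ (inj₁ ()))
noColumns (inj₂ (inj₂ ()))

span : ∀ {S} → Vect S → Subgroup S
span {S} w = record
  { mem   = InSpan
  ; ext   = λ where
      e (inj₁ z) → inj₁ λ i → trans (sym (e i)) (z i)
      e (inj₂ z) → inj₂ λ i → trans (sym (e i)) (z i)
  ; has0  = inj₁ λ _ → refl
  ; close = close-span }
  where
  InSpan : Vect S → Set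
  InSpan v = (∀ i → v i ≡ false) ⊎ (∀ i → v i ≡ w i)
  close-span : ∀ {u v} → InSpan u → InSpan v → InSpan (u ⊕ v)
  close-span (inj₁ a) (inj₁ b) = inj₁ λ i → cong₂ _xor_ (a i) (b i)
  close-span (inj₁ a) (inj₂ b) = inj₂ λ i → cong₂ _xor_ (a i) (b i)
  close-span (inj₂ a) (inj₁ b) = inj₂ λ i → trans (cong₂ _xor_ (a i) (b i)) (xor-identityʳ (w i))
  close-span (inj₂ a) (inj₂ b) = inj₁ λ i → trans (cong₂ _xor_ (a i) (b i)) (xor-same (w i))

span-⊆ : ∀ {S} (G : Subgroup S) {w} → mem G w → ∀ v → mem (span w) v → mem G v
span-⊆ G _  v (inj₁ z) = ext G (λ i → sym (z i)) (has0 G)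
span-⊆ G Gw v (inj₂ e) = ext G (λ i → sym (e i)) Gw

trivial-⊆ : ∀ {S} (G : Subgroup S) v → mem trivSG v → mem G v
trivial-⊆ G v z = ext G (λ i → sym (z i)) (has0 G)

_++ᵐ_ : ∀ {c x y0 y1 c' x' y0' y1' c'' x'' y0'' y1''}
          {Φ : Template c x y0 y1} {Ψ : Template c' x' y0' y1'} {Θ : Template c'' x'' y0'' y1''} →
        TMinor Φ Ψ → TMinor Ψ Θ → TMinor Φ Θ
m ++ᵐ done     = m
m ++ᵐ step n s = step (m ++ᵐ n) s

single : ∀ {c x y0 y1 c' x' y0' y1'} {Φ : Template c x y0 y1} {Ψ : Template c' x' y0' y1'} →
         Step Φ Ψ → TMinor Φ Ψ
single = step done

⪯-trans : ∀ {c x y0 y1 c' x' y0' y1' c'' x'' y0'' y1''}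
            {Φ : Template c x y0 y1} {Ψ : Template c' x' y0' y1'} {Θ : Template c'' x'' y0'' y1''} →
          Φ ⪯ Ψ → Ψ ⪯ Θ → Φ ⪯ Θ
⪯-trans Φ⪯Ψ Ψ⪯Θ n M = Ψ⪯Θ n M ∘ Φ⪯Ψ n M

minor⇒⪯ : ∀ {c x y0 y1 c' x' y0' y1'} {Φ : Template c x y0 y1} {Ψ : Template c' x' y0' y1'} →
          TMinor Ψ Φ → Φ ⪯ Ψ
minor⇒⪯ Ψ→Φ n M (c , x , y0 , y1 , Θ , Φ→Θ , conf) = c , x , y0 , y1 , Θ , Ψ→Φ ++ᵐ Φ→Θ , conf

-- Without function extensionality two empty matrices A1 need not be equal, so templates
-- without columns are compared through Δ and Λ alone.
data SameGroups : ∀ {c x y0 y1} → Template c x y0 y1 → Template c x y0 y1 → Set₁ where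
  same : ∀ {x} {Ψ Ψ' : Template 0 x 0 0} → Δ Ψ ≡ Δ Ψ' → Λ Ψ ≡ Λ Ψ' → SameGroups Ψ Ψ'

step-SameGroups : ∀ {c x y0 y1 c' x' y0' y1'} {Ψ Ψ' : Template c x y0 y1} {Θ : Template c' x' y0' y1'} →
                  SameGroups Ψ Ψ' → Step Ψ Θ → Σ[ Θ' ∈ Template c' x' y0' y1' ] (Step Ψ' Θ' × SameGroups Θ Θ')
step-SameGroups {Ψ' = Ψ'} (same refl refl) (op2 _ Λ' Λ'⊆Λ) = _ , op2 Ψ' Λ' Λ'⊆Λ , same refl refl
step-SameGroups {Ψ' = Ψ'} (same refl refl) (op3 _ Δ' Δ'⊆Δ) = _ , op3 Ψ' Δ' Δ'⊆Δ , same refl refl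
step-SameGroups {Ψ' = Ψ'} (same refl refl) (op5swap _ i j) = _ , op5swap Ψ' i j , same refl refl
step-SameGroups {Ψ' = Ψ'} (same refl refl) (op5add _ i j i≢j) = _ , op5add Ψ' i j i≢j , same refl refl
step-SameGroups {Ψ' = Ψ'} (same refl refl) (op6 _ p _ Λ-zero) =
  _ , op6 Ψ' p (⊥-elim ∘ noColumns) Λ-zero , same refl refl

minor-SameGroups : ∀ {c x y0 y1 c' x' y0' y1'} {Ψ Ψ' : Template c x y0 y1} {Θ : Template c' x' y0' y1'} →
                   SameGroups Ψ Ψ' → TMinor Ψ Θ → Σ[ Θ' ∈ Template c' x' y0' y1' ] (TMinor Ψ' Θ' × SameGroups Θ Θ')
minor-SameGroups sg done = _ , done , sg
minor-SameGroups sg (step Ψ→Θ s) with minor-SameGroups sg Ψ→Θ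
... | Θ' , Ψ'→Θ' , sg' with step-SameGroups sg' s
...   | Θ'' , s' , sg'' = Θ'' , step Ψ'→Θ' s' , sg''

conforms-SameGroups : ∀ {c x y0 y1} {Ψ Ψ' : Template c x y0 y1} {n} {M : SetSys (Fin n)} →
                      SameGroups Ψ Ψ' → VConformsM Ψ M → VConformsM Ψ' M
conforms-SameGroups (same refl refl) (b , z , w , A , (A' , (_ , resp) , agree) , iso) =
  b , z , w , A , (A' , ((λ _ → ⊥-elim ∘ noColumns) , resp) , agree) , iso

SameGroups⇒⪯ : ∀ {c x y0 y1} {Ψ Ψ' : Template c x y0 y1} → SameGroups Ψ Ψ' → Ψ ⪯ Ψ'
SameGroups⇒⪯ sg n M (c , x , y0 , y1 , Θ , Ψ→Θ , conf) with minor-SameGroups sg Ψ→Θ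
... | Θ' , Ψ'→Θ' , sg' = c , x , y0 , y1 , Θ' , Ψ'→Θ' , conforms-SameGroups {M = M} sg' conf

UnitColumn : ∀ {c x y0 y1} → (Fin x → TCols c y0 y1 → Bool) → Fin c → Fin x → Set
UnitColumn A k p = ∀ r → A r (colC k) ≡ (r == p)

record Pivoted {c x y0 y1} (A : Fin x → TCols c y0 y1 → Bool) (P : Fin x → Bool) : Set where
  field
    off-pivot : ∀ k r → P r ≡ false → A r (colC k) ≡ false
    pivot     : ∀ p → P p ≡ true → Σ[ k ∈ Fin c ] UnitColumn A k p
open Pivoted

OffWitness : ∀ {x} → (Fin x → Bool) → Subgroup (Fin x) → Set
OffWitness {x} P G = Σ[ v ∈ Vect (Fin x) ] (mem G v × Σ[ i ∈ Fin x ] (P i ≡ false × v i ≡ true))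

nontrivial⇒offWitness : ∀ {x} {P : Fin x → Bool} {G : Subgroup (Fin x)} →
                        Nontrivial (proj {S' = Σ[ i ∈ Fin x ] P i ≡ false} proj₁ G) → OffWitness P G
nontrivial⇒offWitness (_ , (u , u∈G , u≡v) , (i , i∉P) , vi) = u , u∈G , i , i∉P , trans (u≡v (i , i∉P)) vi

module _ {c x y0 y1} {Φ : Template c x y0 y1} (sf : StandardForm Φ) where

  σ-unitColumn : ∀ i (i∈X0 : X0 sf i ≡ true) → UnitColumn (A1 Φ) (σ sf i i∈X0) i
  σ-unitColumn i i∈X0 r with r ≟ i | X0 sf r in r∈X0?
  ... | yes refl | _     = trans (ident sf i i∈X0 _ (σ-in sf i i∈X0)) (==-refl (σ sf i i∈X0))
  ... | no r≢i   | true  = trans (ident sf r r∈X0? _ (σ-in sf i i∈X0))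
                                 (==-≢ (r≢i ∘ σ-inj sf r i r∈X0? i∈X0))
  ... | no r≢i   | false = zeroX1 sf r r∈X0? _

  standardForm-pivoted : Pivoted (A1 Φ) (X0 sf)
  standardForm-pivoted = record
    { off-pivot = λ k r r∉X0 → zeroX1 sf r r∉X0 k
    ; pivot     = λ p p∈X0 → σ sf p p∈X0 , σ-unitColumn p p∈X0 }

pivoted-contract : ∀ {c x y0 y1} {A : Fin (suc x) → TCols (suc c) y0 y1 → Bool} {P k p} →
                   Pivoted A P → UnitColumn A k p →
                   Pivoted (λ r t → A (punchIn p r) (embC k t)) (P ∘ punchIn p)
pivoted-contract {A = A} {P} {k} {p} piv k-unit = record
  { off-pivot = λ k' r → off-pivot piv (punchIn k k') (punchIn p r)
  ; pivot     = pivot' }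
  where
  pivot' : ∀ q → P (punchIn p q) ≡ true → Σ[ k' ∈ _ ] UnitColumn (λ r t → A (punchIn p r) (embC k t)) k' q
  pivot' q q∈P with pivot piv (punchIn p q) q∈P
  ... | k' , k'-unit with punchIn-surjective {P = λ j → UnitColumn A j (punchIn p q)} k k≢k' k'-unit
    where
    -- at row p the column k has a 1, the column k' a 0
    k≢k' : k ≢ k'
    k≢k' refl = true≢false (trans (sym (trans (k-unit p) (==-refl p)))
                                  (trans (k'-unit p) (==-≢ (punchInᵢ≢i p q ∘ sym))))
  ... | j , j-unit = j , λ r → trans (j-unit (punchIn p r)) (==-punchIn p r q)

offWitness-punchIn : ∀ {x} {P : Fin (suc x) → Bool} {G : Subgroup (Fin (suc x))} {p} →
                     P p ≡ true → OffWitness P G → OffWitness (P ∘ punchIn p) (proj (punchIn p) G)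
offWitness-punchIn {P = P} {p = p} p∈P (u , u∈G , i , i∉P , ui)
  with punchIn-surjective {P = λ j → P j ≡ false × u j ≡ true} p p≢i (i∉P , ui)
  where
  p≢i : p ≢ i
  p≢i p≡i = true≢false (trans (sym p∈P) (trans (cong P p≡i) i∉P))
... | j , j∉P , uj = u ∘ punchIn p , (u , u∈G , λ _ → refl) , j , j∉P , uj

pivoted-delete : ∀ {c x y0 y1} {A : Fin x → TCols (suc c) y0 y1 → Bool} {P k} →
                 Pivoted A P → (∀ r → P r ≢ true) → Pivoted (λ r t → A r (embC k t)) P
pivoted-delete {k = k} piv P-empty = record
  { off-pivot = λ k' → off-pivot piv (punchIn k k')
  ; pivot     = λ p p∈P → ⊥-elim (P-empty p p∈P) }

withTrivialΔ : ∀ {c x y0 y1} → Template c x y0 y1 → Template c x y0 y1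
withTrivialΔ Θ = record { A1 = A1 Θ ; Δ = trivSG ; Λ = Λ Θ }

trivializeΔ : ∀ {c x y0 y1} (Θ : Template c x y0 y1) → TMinor Θ (withTrivialΔ Θ)
trivializeΔ Θ = single (op3 Θ trivSG (trivial-⊆ (Δ Θ)))

PivotedMinor : ∀ {c x y0 y1} → Template c x y0 y1 → ℕ → Set₁
PivotedMinor {y0 = y0} {y1} Θ c' =
  Σ[ x' ∈ ℕ ] Σ[ Θ' ∈ Template c' x' y0 y1 ] (TMinor Θ Θ' ×
    Σ[ P ∈ (Fin x' → Bool) ] (Pivoted (A1 Θ') P × OffWitness P (Λ Θ')))

removeC : ∀ {c x y0 y1} (Θ : Template (suc c) x y0 y1) {P} →
          Pivoted (A1 Θ) P → OffWitness P (Λ Θ) → PivotedMinor Θ c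
removeC Θ {P} piv wit with any? (λ r → P r Bool.≟ true)
removeC {x = suc _} Θ {P} piv wit | yes (p , p∈P) with pivot piv p p∈P
... | k , k-unit =
  _ , _ , trivializeΔ Θ ++ᵐ single (op7 (withTrivialΔ Θ) k p k-unit (inj₂ λ _ δ≡0 → δ≡0 (colC k))) ,
  P ∘ punchIn p , pivoted-contract piv k-unit , offWitness-punchIn {G = Λ Θ} p∈P wit
removeC Θ {P} piv wit | no P-empty =
  _ , _ , trivializeΔ Θ ++ᵐ single (op8 (withTrivialΔ Θ) Fin.zero zero-column
                                        λ _ δ≡0 → δ≡0 (colC Fin.zero)) ,
  P , pivoted-delete piv (λ r r∈P → P-empty (r , r∈P)) , wit
  where
  zero-column : ∀ r → A1 Θ r (colC Fin.zero) ≡ false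
  zero-column r = off-pivot piv Fin.zero r (Bool.¬-not λ r∈P → P-empty (r , r∈P))

eliminateC : ∀ c {x y0 y1} (Θ : Template c x y0 y1) {P} → Pivoted (A1 Θ) P → OffWitness P (Λ Θ) →
             Σ[ x' ∈ ℕ ] Σ[ Θ' ∈ Template 0 x' y0 y1 ] (TMinor Θ Θ' × Nontrivial (Λ Θ'))
eliminateC zero    Θ _ (u , u∈Λ , i , _ , ui) = _ , Θ , done , u , u∈Λ , i , ui
eliminateC (suc c) Θ piv wit with removeC Θ piv wit
... | _ , Θ' , Θ→Θ' , _ , piv' , wit' with eliminateC c Θ' piv' wit'
...   | x'' , Θ'' , Θ'→Θ'' , nt = x'' , Θ'' , Θ→Θ' ++ᵐ Θ'→Θ'' , nt

eliminateY1 : ∀ y1 {c x y0} (Θ : Template c x y0 y1) → Nontrivial (Λ Θ) →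
              Σ[ Θ' ∈ Template c x y0 0 ] (TMinor Θ Θ' × Nontrivial (Λ Θ'))
eliminateY1 zero     Θ nt = Θ , done , nt
eliminateY1 (suc y1) Θ nt with eliminateY1 y1 _ nt
... | Θ' , m , nt' = Θ' , single (op4 Θ Fin.zero) ++ᵐ m , nt'

eliminateY0 : ∀ y0 {c x y1} (Θ : Template c x y0 y1) → Nontrivial (Λ Θ) →
              Σ[ Θ' ∈ Template c x 0 y1 ] (TMinor Θ Θ' × Nontrivial (Λ Θ'))
eliminateY0 zero     Θ nt = Θ , done , nt
eliminateY0 (suc y0) Θ nt with eliminateY0 y0 _ nt
... | Θ' , m , nt' = Θ' , single (op10 Θ Fin.zero) ++ᵐ m , nt'

clearEntry : ∀ {c x y0 y1} (Θ : Template c x y0 y1) {i p u} → i ≢ p → mem (Λ Θ) u → u i ≡ true →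
             Σ[ Θ' ∈ Template c x y0 y1 ] (TMinor Θ Θ' ×
               Σ[ w ∈ Vect (Fin x) ] (mem (Λ Θ') w × w i ≡ true × w p ≡ false))
clearEntry Θ {i} {p} {u} i≢p u∈Λ ui with u p in up
... | false = Θ , done , u , u∈Λ , ui , up
... | true  = _ , single (op5add Θ i p i≢p) , w , (u , u∈Λ , λ _ → refl) , wi , wp
  where
  w : Vect _
  w r = u r xor ((r == p) ∧ u i)
  wi : w i ≡ true
  wi rewrite ==-≢ i≢p | ui = refl
  wp : w p ≡ false
  wp rewrite ==-refl p | ui | up = refl

deleteRow : ∀ {c x y0 y1} (Θ : Template c (suc x) y0 y1) {i p w} → (∀ t → A1 Θ p t ≡ false) →
            p ≢ i → mem (Λ Θ) w → w i ≡ true → w p ≡ false →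
            Σ[ Θ' ∈ Template c x y0 y1 ] (TMinor Θ Θ' × Nontrivial (Λ Θ'))
deleteRow Θ {i} {p} {w} row-zero p≢i w∈Λ wi wp with punchIn-surjective {P = λ j → w j ≡ true} p p≢i wi
... | j , wj = _ , step (single (op2 Θ (span w) (span-⊆ (Λ Θ) w∈Λ))) (op6 _ p row-zero span-zero-at-p) ,
               w ∘ punchIn p , (w , inj₂ (λ _ → refl) , λ _ → refl) , j , wj
  where
  span-zero-at-p : ∀ v → mem (span w) v → v p ≡ false
  span-zero-at-p v (inj₁ v≡0) = v≡0 p
  span-zero-at-p v (inj₂ v≡w) = trans (v≡w p) wp

removeRow : ∀ {x} (Θ : Template 0 (suc (suc x)) 0 0) → Nontrivial (Λ Θ) →
            Σ[ Θ' ∈ Template 0 (suc x) 0 0 ] (TMinor Θ Θ' × Nontrivial (Λ Θ'))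
removeRow Θ (u , u∈Λ , i , ui) with clearEntry Θ (punchInᵢ≢i i Fin.zero ∘ sym) u∈Λ ui
... | Θ₁ , Θ→Θ₁ , w , w∈Λ , wi , wp
  with deleteRow Θ₁ (⊥-elim ∘ noColumns) (punchInᵢ≢i i Fin.zero) w∈Λ wi wp
... | Θ₂ , Θ₁→Θ₂ , nt₂ = Θ₂ , Θ→Θ₁ ++ᵐ Θ₁→Θ₂ , nt₂

reduceToOneRow : ∀ x (Θ : Template 0 x 0 0) → Nontrivial (Λ Θ) →
                 Σ[ Θ' ∈ Template 0 1 0 0 ] (TMinor Θ Θ' × Nontrivial (Λ Θ'))
reduceToOneRow zero          Θ (_ , _ , () , _)
reduceToOneRow (suc zero)    Θ nt = Θ , done , nt
reduceToOneRow (suc (suc x)) Θ nt =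
  let Θ' , Θ→Θ' , nt' = removeRow Θ nt
      Θ'' , Θ'→Θ'' , nt'' = reduceToOneRow (suc x) Θ' nt'
  in Θ'' , Θ→Θ' ++ᵐ Θ'→Θ'' , nt''

ΦX′ : (Fin 1 → TCols 0 0 0 → Bool) → Template 0 1 0 0
ΦX′ A = record { A1 = A ; Δ = trivSG ; Λ = fullSG }

oneRow-minor : (Θ : Template 0 1 0 0) → Nontrivial (Λ Θ) → TMinor Θ (ΦX′ (A1 Θ))
oneRow-minor Θ (u , u∈Λ , Fin.zero , u0) =
  step (single (op2 Θ fullSG everything)) (op3 _ trivSG (trivial-⊆ (Δ Θ)))
  where
  everything : ∀ v → ⊤ → mem (Λ Θ) v
  everything v _ with v Fin.zero in v0
  ... | true  = ext (Λ Θ) (λ { Fin.zero → trans u0 (sym v0) }) u∈Λ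
  ... | false = ext (Λ Θ) (λ { Fin.zero → sym v0 }) (has0 (Λ Θ))

lemma3p12 : ∀ {c x y0 y1} (Φ : Template c x y0 y1) (sf : StandardForm Φ) →
    Nontrivial (proj {S' = X1 sf} proj₁ (Λ Φ)) → ΦX ⪯ Φ
lemma3p12 {c} {_} {y0} {y1} Φ sf nt
  with eliminateC c Φ (standardForm-pivoted sf) (nontrivial⇒offWitness {G = Λ Φ} nt)
... | x₁ , Θ₁ , Φ→Θ₁ , nt₁ with eliminateY1 y1 Θ₁ nt₁
... | Θ₂ , Θ₁→Θ₂ , nt₂ with eliminateY0 y0 Θ₂ nt₂
... | Θ₃ , Θ₂→Θ₃ , nt₃ with reduceToOneRow x₁ Θ₃ nt₃
... | Θ₄ , Θ₃→Θ₄ , nt₄ =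
  ⪯-trans (SameGroups⇒⪯ (same refl refl))
          (minor⇒⪯ (Φ→Θ₁ ++ᵐ (Θ₁→Θ₂ ++ᵐ (Θ₂→Θ₃ ++ᵐ (Θ₃→Θ₄ ++ᵐ oneRow-minor Θ₄ nt₄)))))
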